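{- Let $n,r,a\in\mathbb{N}$ with $r>1$. Then: (i) if $f_r-1\le n\le f_{r+1}-1$, then $\chi(n)=(-1)^r\chi(f_{r+2}-2-n)$; (ii) if $2f_r-1\le n\le f_{r-1}+f_{r+1}-1$, then $\chi(n)=0$; (iii) if $0\le n\le f_r-1$ and $a\ge r$, then $\chi(n)=\chi(n+f_a+f_{a+2})$.
   Context: $f_0=f_1=1$, $f_i=f_{i-1}+f_{i-2}$ ($i\ge2$). A Fibonacci partition of $n\in\mathbb{N}$ is a finite set $\{f_{i_1},\dots,f_{i_h}\}$ with $1\le i_1<\dots<i_h$ and sum $n$; $\chi(n)=\sum_{h\ge0}(-1)^hF_h(n)$, where $F_h(n)$ is the number of Fibonacci partitions of $n$ with $h$ parts. Equivalently $\prod_{i\ge1}(1-x^{f_i})=\sum_{n\ge0}\chi(n)x^n$. -}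

module Defs where

open import Data.Nat using (ℕ; zero; suc; _+_; _≟_)
open import Data.Integer as ℤ using (ℤ; +_; -_)
open import Data.List using (List; []; _∷_; map; length; filter; concatMap; upTo)
open import Data.List as L using ()
open import Data.Bool using (if_then_else_)
open import Relation.Nullary.Decidable using (⌊_⌋)
open import Data.Nat.ListAction using (sum)

f : ℕ → ℕ
f zero = 1
f (suc zero) = 1
f (suc (suc i)) = f (suc i) + f i

sgn : ℕ → ℤ
sgn zero = + 1
sgn (suc k) = - sgn k

-- all sublists (= subsets, as the list elements are distinct indices)
sublists : {A : Set} → List A → List (List A)
sublists [] = [] ∷ []
sublists (x ∷ xs) = sublists xs L.++ map (x ∷_) (sublists xs)

-- candidate indices 1 .. n+1 ; any index i with f i ≤ n satisfies i ≤ n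
indices : ℕ → List ℕ
indices n = map suc (upTo (suc n))

-- Fibonacci partitions of n: sets of indices {i_1 < ... < i_h}, i_1 ≥ 1,
-- with f i_1 + ... + f i_h = n  (indices beyond n+1 give parts > n)
fibPartitions : ℕ → List (List ℕ)
fibPartitions n = filter (λ S → sum (map f S) ≟ n) (sublists (indices n))

χ : ℕ → ℤ
χ n = L.foldr ℤ._+_ (+ 0) (map (λ S → sgn (length S)) (fibPartitions n))

-- χ n is the coefficient of x^n in P = ∏_{i ≥ 1} (1 - x^(f i)); for n < f (k+1) it is already the
-- coefficient of the truncation P_k = ∏_{i=1}^{k} (1 - x^(f i)), as the remaining factors only touch
-- degrees ≥ f (k+1). P_k has degree D_k = f 1 + ... + f k = f (k+2) - 2 and is (-1)^k-palindromic,
-- which is (i). For (ii), P_(r+1) = P_r (1 - x^(f (r+1))); near n both coefficients of P_r are, after one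
-- reflection, the same coefficient of P_(r-2) with the same sign, so they cancel. For (iii), expanding
-- P_(a+3) = P_(a-1) (1 - x^(f a)) ... (1 - x^(f (a+3))) at n + f a + f (a+2), every term other than χ n
-- falls outside [0, D_(a-1)] or cancels against another one.
module Submission where

open import Defs

module FibonacciProduct where

  open import Data.Nat as ℕ using (ℕ; zero; suc; _≤_; _<_; _≤′_; ≤′-refl; ≤′-step; z≤n; s≤s)
  import Data.Nat.Properties as ℕP
  import Data.Nat.Tactic.RingSolver as ℕSolver
  open import Data.Integer as ℤ using (ℤ; +_; +0; +[1+_]; -[1+_]; 0ℤ; 1ℤ; _+_; _-_; -_; _*_; +<+)
  import Data.Integer.Properties as ℤP
  open import Data.Integer.Tactic.RingSolver using (solve-∀)
  open import Data.List using (List; []; _∷_; _∷ʳ_; _++_; map; filter; upTo; length; foldr)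
  import Data.List.Properties as ListP
  open import Data.Nat.ListAction using (sum)
  open import Data.Bool using (true; false; if_then_else_)
  open import Relation.Nullary using (Dec; does; yes; no; ¬_; contradiction)
  open import Relation.Unary using (Decidable)
  open import Relation.Binary.PropositionalEquality
  open import Data.Sum using (inj₁; inj₂)
  open import Function using (_∘_)

  f-pos : ∀ k → 0 < f k
  f-pos zero = s≤s z≤n
  f-pos (suc zero) = s≤s z≤n
  f-pos (suc (suc k)) = ℕP.≤-trans (f-pos (suc k)) (ℕP.m≤m+n (f (suc k)) (f k))

  f-≤-suc : ∀ k → f k ≤ f (suc k)
  f-≤-suc zero = ℕP.≤-refl
  f-≤-suc (suc k) = ℕP.m≤m+n (f (suc k)) (f k)

  f-mono : ∀ {j k} → j ≤ k → f j ≤ f k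
  f-mono = go ∘ ℕP.≤⇒≤′
    where
    go : ∀ {j k} → j ≤′ k → f j ≤ f k
    go ≤′-refl = ℕP.≤-refl
    go (≤′-step {k} j≤k) = ℕP.≤-trans (go j≤k) (f-≤-suc k)

  n<f[1+n] : ∀ n → n < f (suc n)
  n<f[1+n] zero = s≤s z≤n
  n<f[1+n] (suc n) = ℕP.≤-trans (s≤s (n<f[1+n] n)) (ℕP.m<m+n (f (suc n)) (f-pos n))

  fibSum : ℕ → ℕ
  fibSum zero = 0
  fibSum (suc k) = fibSum k ℕ.+ f (suc k)

  fibSum-+2 : ∀ k → fibSum k ℕ.+ 2 ≡ f (2 ℕ.+ k)
  fibSum-+2 zero = refl
  fibSum-+2 (suc k) = trans (swap (fibSum k) (f (suc k))) (cong (ℕ._+ f (suc k)) (fibSum-+2 k))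
    where
    swap : ∀ d a → d ℕ.+ a ℕ.+ 2 ≡ d ℕ.+ 2 ℕ.+ a
    swap = ℕSolver.solve-∀

  fibSum<f[2+k] : ∀ k → fibSum k < f (2 ℕ.+ k)
  fibSum<f[2+k] k = ℕP.<-≤-trans (ℕP.m<m+n (fibSum k) (s≤s z≤n)) (ℕP.≤-reflexive (fibSum-+2 k))

  i<j⇒i-j<0 : ∀ {i j} → i ℤ.< j → i - j ℤ.< 0ℤ
  i<j⇒i-j<0 {j = j} i<j = ℤP.<-≤-trans (ℤP.+-monoˡ-< (- j) i<j) (ℤP.≤-reflexive (ℤP.+-inverseʳ j))

  m<n+o⇒m-o<n : ∀ {m n o} → m < n ℕ.+ o → + m - + o ℤ.< + n
  m<n+o⇒m-o<n {m} {n} {o} m<n+o =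
    ℤP.<-≤-trans (ℤP.+-monoˡ-< (- + o) (+<+ m<n+o)) (ℤP.≤-reflexive (cancel (+ n) (+ o)))
    where
    cancel : ∀ x y → x + y - y ≡ x
    cancel = solve-∀

  δ : ℤ → ℤ
  δ +0 = 1ℤ
  δ +[1+ _ ] = 0ℤ
  δ -[1+ _ ] = 0ℤ

  -- coeff is m is the coefficient of x^m in the product of (1 - x^(f i)) over i in is,
  -- so χ[ k ] is the truncation of χ to the factors 1 ≤ i ≤ k.
  coeff : List ℕ → ℤ → ℤ
  coeff [] = δ
  coeff (i ∷ is) m = coeff is m - coeff is (m - + f i)

  χ[_] : ℕ → ℤ → ℤ
  χ[ k ] = coeff (map suc (upTo k))

  sumBy : {A : Set} → (A → ℤ) → List A → ℤ
  sumBy g xs = foldr _+_ 0ℤ (map g xs)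

  sumBy-++ : {A : Set} (g : A → ℤ) (xs ys : List A) → sumBy g (xs ++ ys) ≡ sumBy g xs + sumBy g ys
  sumBy-++ g [] ys = sym (ℤP.+-identityˡ _)
  sumBy-++ g (x ∷ xs) ys = trans (cong (_+_ (g x)) (sumBy-++ g xs ys)) (sym (ℤP.+-assoc (g x) _ _))

  sumBy-map : {A B : Set} (g : B → ℤ) (k : A → B) (xs : List A) → sumBy g (map k xs) ≡ sumBy (g ∘ k) xs
  sumBy-map g k xs = cong (foldr _+_ 0ℤ) (sym (ListP.map-∘ xs))

  sumBy-neg : {A : Set} (g : A → ℤ) (xs : List A) → sumBy (-_ ∘ g) xs ≡ - sumBy g xs
  sumBy-neg g [] = refl
  sumBy-neg g (x ∷ xs) = trans (cong (_+_ (- g x)) (sumBy-neg g xs)) (sym (ℤP.neg-distrib-+ (g x) _))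

  sumBy-filter : {A : Set} {P : A → Set} (P? : Decidable P) (g : A → ℤ) (xs : List A) →
    sumBy g (filter P? xs) ≡ sumBy (λ x → if does (P? x) then g x else 0ℤ) xs
  sumBy-filter P? g [] = refl
  sumBy-filter P? g (x ∷ xs) with does (P? x)
  ... | true = cong (_+_ (g x)) (sumBy-filter P? g xs)
  ... | false = trans (sumBy-filter P? g xs) (sym (ℤP.+-identityˡ _))

  signedIndicator : ℕ → ℕ → List ℕ → ℤ
  signedIndicator c n S = if does (c ℕ.+ sum (map f S) ℕ.≟ n) then sgn (length S) else 0ℤ

  if-dec : ∀ {A : Set} {x y z : ℤ} (d : Dec A) → (A → x ≡ z) → (¬ A → y ≡ z) → (if does d then x else y) ≡ z
  if-dec (yes a) onYes onNo = onYes a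
  if-dec (no ¬a) onYes onNo = onNo ¬a

  if-neg : ∀ b x → (if b then - x else 0ℤ) ≡ - (if b then x else 0ℤ)
  if-neg true x = refl
  if-neg false x = refl

  signedIndicator-[] : ∀ c n → signedIndicator c n [] ≡ δ (+ n - + c)
  signedIndicator-[] c n = if-dec (c ℕ.+ 0 ℕ.≟ n) onTarget offTarget
    where
    onTarget : c ℕ.+ 0 ≡ n → 1ℤ ≡ δ (+ n - + c)
    onTarget c+0≡n = cong δ (sym (trans (cong (λ k → + n - + k) (trans (sym (ℕP.+-identityʳ c)) c+0≡n))
                                        (ℤP.+-inverseʳ (+ n))))
    offTarget : c ℕ.+ 0 ≢ n → 0ℤ ≡ δ (+ n - + c)
    offTarget c+0≢n = sym (δ-nonzero (c+0≢n ∘ trans (ℕP.+-identityʳ c) ∘ sym ∘ ℤP.+-injective ∘ ℤP.i-j≡0⇒i≡j (+ n) (+ c)))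
      where
      δ-nonzero : ∀ {m} → m ≢ 0ℤ → δ m ≡ 0ℤ
      δ-nonzero {+0} m≢0 = contradiction refl m≢0
      δ-nonzero {+[1+ _ ]} _ = refl
      δ-nonzero { -[1+ _ ]} _ = refl

  signedIndicator-∷ : ∀ c n i S → signedIndicator c n (i ∷ S) ≡ - signedIndicator (c ℕ.+ f i) n S
  signedIndicator-∷ c n i S =
    trans (cong (λ t → if does (t ℕ.≟ n) then - sgn (length S) else 0ℤ) (sym (ℕP.+-assoc c (f i) (sum (map f S)))))
          (if-neg (does (c ℕ.+ f i ℕ.+ sum (map f S) ℕ.≟ n)) (sgn (length S)))

  sumBy-signedIndicator : ∀ c n is → sumBy (signedIndicator c n) (sublists is) ≡ coeff is (+ n - + c)
  sumBy-signedIndicator c n [] = trans (ℤP.+-identityʳ _) (signedIndicator-[] c n)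
  sumBy-signedIndicator c n (i ∷ is) = begin
      sumBy (signedIndicator c n) (sublists is ++ map (i ∷_) (sublists is))
    ≡⟨ sumBy-++ (signedIndicator c n) (sublists is) _ ⟩
      sumBy (signedIndicator c n) (sublists is) + sumBy (signedIndicator c n) (map (i ∷_) (sublists is))
    ≡⟨ cong (_+_ (sumBy (signedIndicator c n) (sublists is))) prefixed ⟩
      sumBy (signedIndicator c n) (sublists is) - sumBy (signedIndicator (c ℕ.+ f i) n) (sublists is)
    ≡⟨ cong₂ _-_ (sumBy-signedIndicator c n is) (sumBy-signedIndicator (c ℕ.+ f i) n is) ⟩
      coeff is (+ n - + c) - coeff is (+ n - (+ c + + f i))
    ≡⟨ cong (λ t → coeff is (+ n - + c) - coeff is t) (sub-+ (+ n) (+ c) (+ f i)) ⟩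
      coeff is (+ n - + c) - coeff is (+ n - + c - + f i)
    ∎
    where
    open ≡-Reasoning
    prefixed : sumBy (signedIndicator c n) (map (i ∷_) (sublists is)) ≡ - sumBy (signedIndicator (c ℕ.+ f i) n) (sublists is)
    prefixed = begin
        sumBy (signedIndicator c n) (map (i ∷_) (sublists is))
      ≡⟨ sumBy-map (signedIndicator c n) (i ∷_) (sublists is) ⟩
        sumBy (signedIndicator c n ∘ (i ∷_)) (sublists is)
      ≡⟨ cong (foldr _+_ 0ℤ) (ListP.map-cong (signedIndicator-∷ c n i) (sublists is)) ⟩
        sumBy (-_ ∘ signedIndicator (c ℕ.+ f i) n) (sublists is)
      ≡⟨ sumBy-neg (signedIndicator (c ℕ.+ f i) n) (sublists is) ⟩
        - sumBy (signedIndicator (c ℕ.+ f i) n) (sublists is)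
      ∎
    sub-+ : ∀ x y z → x - (y + z) ≡ x - y - z
    sub-+ = solve-∀

  χ≡χ[1+n] : ∀ n → χ n ≡ χ[ suc n ] (+ n)
  χ≡χ[1+n] n = begin
      χ n
    ≡⟨ sumBy-filter (λ S → sum (map f S) ℕ.≟ n) (sgn ∘ length) (sublists (indices n)) ⟩
      sumBy (signedIndicator 0 n) (sublists (indices n))
    ≡⟨ sumBy-signedIndicator 0 n (indices n) ⟩
      coeff (indices n) (+ n - + 0)
    ≡⟨ cong (coeff (indices n)) (ℤP.+-identityʳ (+ n)) ⟩
      χ[ suc n ] (+ n)
    ∎
    where open ≡-Reasoning

  coeff-∷ʳ : ∀ is j m → coeff (is ∷ʳ j) m ≡ coeff is m - coeff is (m - + f j)
  coeff-∷ʳ [] j m = refl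
  coeff-∷ʳ (i ∷ is) j m = begin
      coeff (is ∷ʳ j) m - coeff (is ∷ʳ j) (m - + f i)
    ≡⟨ cong₂ _-_ (coeff-∷ʳ is j m) (coeff-∷ʳ is j (m - + f i)) ⟩
      (coeff is m - coeff is (m - + f j)) - (coeff is (m - + f i) - coeff is (m - + f i - + f j))
    ≡⟨ cong (λ t → (coeff is m - coeff is (m - + f j)) - (coeff is (m - + f i) - coeff is t)) (sub-comm m (+ f i) (+ f j)) ⟩
      (coeff is m - coeff is (m - + f j)) - (coeff is (m - + f i) - coeff is (m - + f j - + f i))
    ≡⟨ exchange (coeff is m) _ _ _ ⟩
      (coeff is m - coeff is (m - + f i)) - (coeff is (m - + f j) - coeff is (m - + f j - + f i))
    ∎
    where
    open ≡-Reasoning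
    sub-comm : ∀ x y z → x - y - z ≡ x - z - y
    sub-comm = solve-∀
    exchange : ∀ a b c d → (a - b) - (c - d) ≡ (a - c) - (b - d)
    exchange = solve-∀

  χ[]-suc : ∀ k m → χ[ suc k ] m ≡ χ[ k ] m - χ[ k ] (m - + f (suc k))
  χ[]-suc k m = begin
      coeff (map suc (upTo (suc k))) m
    ≡⟨ cong (λ is → coeff (map suc is) m) (sym (ListP.upTo-∷ʳ k)) ⟩
      coeff (map suc (upTo k ∷ʳ k)) m
    ≡⟨ cong (λ is → coeff is m) (ListP.map-++ suc (upTo k) (k ∷ [])) ⟩
      coeff (map suc (upTo k) ∷ʳ suc k) m
    ≡⟨ coeff-∷ʳ (map suc (upTo k)) (suc k) m ⟩
      χ[ k ] m - χ[ k ] (m - + f (suc k))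
    ∎
    where open ≡-Reasoning

  χ[]-vanishes-below : ∀ k {m} → m ℤ.< 0ℤ → χ[ k ] m ≡ 0ℤ
  χ[]-vanishes-below zero {+[1+ _ ]} (+<+ ())
  χ[]-vanishes-below zero { -[1+ _ ]} _ = refl
  χ[]-vanishes-below (suc k) {m} m<0 = begin
      χ[ suc k ] m
    ≡⟨ χ[]-suc k m ⟩
      χ[ k ] m - χ[ k ] (m - + f (suc k))
    ≡⟨ cong₂ _-_ (χ[]-vanishes-below k m<0) (χ[]-vanishes-below k (ℤP.≤-<-trans (ℤP.i-j≤i m (+ f (suc k))) m<0)) ⟩
      0ℤ
    ∎
    where open ≡-Reasoning

  χ[]-reflect : ∀ k m → χ[ k ] (+ fibSum k - m) ≡ sgn k * χ[ k ] m
  χ[]-reflect zero +0 = refl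
  χ[]-reflect zero +[1+ _ ] = refl
  χ[]-reflect zero -[1+ _ ] = refl
  χ[]-reflect (suc k) m = begin
      χ[ suc k ] (D + F - m)
    ≡⟨ χ[]-suc k (D + F - m) ⟩
      χ[ k ] (D + F - m) - χ[ k ] (D + F - m - F)
    ≡⟨ cong₂ (λ u v → χ[ k ] u - χ[ k ] v) (shift-out D F m) (cancel-F D F m) ⟩
      χ[ k ] (D - (m - F)) - χ[ k ] (D - m)
    ≡⟨ cong₂ _-_ (χ[]-reflect k (m - F)) (χ[]-reflect k m) ⟩
      sgn k * χ[ k ] (m - F) - sgn k * χ[ k ] m
    ≡⟨ factor (sgn k) (χ[ k ] m) (χ[ k ] (m - F)) ⟩
      - sgn k * (χ[ k ] m - χ[ k ] (m - F))
    ≡⟨ cong (_*_ (- sgn k)) (sym (χ[]-suc k m)) ⟩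
      sgn (suc k) * χ[ suc k ] m
    ∎
    where
    open ≡-Reasoning
    D = + fibSum k
    F = + f (suc k)
    shift-out : ∀ d x y → d + x - y ≡ d - (y - x)
    shift-out = solve-∀
    cancel-F : ∀ d x y → d + x - y - x ≡ d - y
    cancel-F = solve-∀
    factor : ∀ s a b → s * b - s * a ≡ - s * (a - b)
    factor = solve-∀

  χ[]-reflect′ : ∀ k m → χ[ k ] m ≡ sgn k * χ[ k ] (+ fibSum k - m)
  χ[]-reflect′ k m = trans (cong χ[ k ] (sym (involution (+ fibSum k) m))) (χ[]-reflect k (+ fibSum k - m))
    where
    involution : ∀ d x → d - (d - x) ≡ x
    involution = solve-∀

  χ[]-vanishes-above : ∀ k {m} → + fibSum k ℤ.< m → χ[ k ] m ≡ 0ℤ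
  χ[]-vanishes-above k {m} D<m = begin
      χ[ k ] m
    ≡⟨ χ[]-reflect′ k m ⟩
      sgn k * χ[ k ] (+ fibSum k - m)
    ≡⟨ cong (_*_ (sgn k)) (χ[]-vanishes-below k (i<j⇒i-j<0 D<m)) ⟩
      sgn k * 0ℤ
    ≡⟨ ℤP.*-zeroʳ (sgn k) ⟩
      0ℤ
    ∎
    where open ≡-Reasoning

  χ[]-stable : ∀ {j k m} → j ≤ k → m ℤ.< + f (suc j) → χ[ k ] m ≡ χ[ j ] m
  χ[]-stable {j} {m = m} j≤k m<f = go (ℕP.≤⇒≤′ j≤k)
    where
    go : ∀ {k} → j ≤′ k → χ[ k ] m ≡ χ[ j ] m
    go ≤′-refl = refl
    go (≤′-step {k} j≤k) = begin
        χ[ suc k ] m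
      ≡⟨ χ[]-suc k m ⟩
        χ[ k ] m - χ[ k ] (m - + f (suc k))
      ≡⟨ cong (_-_ (χ[ k ] m)) (χ[]-vanishes-below k below) ⟩
        χ[ k ] m - 0ℤ
      ≡⟨ ℤP.+-identityʳ (χ[ k ] m) ⟩
        χ[ k ] m
      ≡⟨ go j≤k ⟩
        χ[ j ] m
      ∎
      where
      open ≡-Reasoning
      below : m - + f (suc k) ℤ.< 0ℤ
      below = i<j⇒i-j<0 (ℤP.<-≤-trans m<f (ℤ.+≤+ (f-mono (s≤s (ℕP.≤′⇒≤ j≤k)))))

  χ-truncate : ∀ k {n} → n < f (suc k) → χ n ≡ χ[ k ] (+ n)
  χ-truncate k {n} n<f with ℕP.≤-total k (suc n)
  ... | inj₁ k≤1+n = trans (χ≡χ[1+n] n) (χ[]-stable k≤1+n (+<+ n<f))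
  ... | inj₂ 1+n≤k = trans (χ≡χ[1+n] n) (sym (χ[]-stable 1+n≤k (+<+ (ℕP.<-trans (ℕP.n<1+n n) (n<f[1+n] (suc n))))))

  χ[]-gap : ∀ b n → fibSum (2 ℕ.+ b) < f (1 ℕ.+ b) ℕ.+ n → n < f (1 ℕ.+ b) ℕ.+ f (3 ℕ.+ b) →
    χ[ 3 ℕ.+ b ] (+ n) ≡ 0ℤ
  χ[]-gap b n reflectedInRange shiftedInRange = begin
      χ[ 3 ℕ.+ b ] (+ n)
    ≡⟨ χ[]-suc (2 ℕ.+ b) (+ n) ⟩
      χ[ 2 ℕ.+ b ] (+ n) - χ[ 2 ℕ.+ b ] (+ n - + f (3 ℕ.+ b))
    ≡⟨ cong₂ _-_ reflected shifted ⟩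
      sgn b * χ[ b ] (+ fibSum (2 ℕ.+ b) - + n) - sgn b * χ[ b ] (+ fibSum (2 ℕ.+ b) - + n)
    ≡⟨ ℤP.+-inverseʳ (sgn b * χ[ b ] (+ fibSum (2 ℕ.+ b) - + n)) ⟩
      0ℤ
    ∎
    where
    open ≡-Reasoning
    reflected : χ[ 2 ℕ.+ b ] (+ n) ≡ sgn b * χ[ b ] (+ fibSum (2 ℕ.+ b) - + n)
    reflected = begin
        χ[ 2 ℕ.+ b ] (+ n)
      ≡⟨ χ[]-reflect′ (2 ℕ.+ b) (+ n) ⟩
        - - sgn b * χ[ 2 ℕ.+ b ] (+ fibSum (2 ℕ.+ b) - + n)
      ≡⟨ cong₂ _*_ (ℤP.neg-involutive (sgn b)) (χ[]-stable (ℕP.m≤n+m b 2) (m<n+o⇒m-o<n reflectedInRange)) ⟩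
        sgn b * χ[ b ] (+ fibSum (2 ℕ.+ b) - + n)
      ∎
    shifted : χ[ 2 ℕ.+ b ] (+ n - + f (3 ℕ.+ b)) ≡ sgn b * χ[ b ] (+ fibSum (2 ℕ.+ b) - + n)
    shifted = begin
        χ[ 2 ℕ.+ b ] (+ n - + f (3 ℕ.+ b))
      ≡⟨ χ[]-stable (ℕP.m≤n+m b 2) (m<n+o⇒m-o<n shiftedInRange) ⟩
        χ[ b ] (+ n - + f (3 ℕ.+ b))
      ≡⟨ χ[]-reflect′ b _ ⟩
        sgn b * χ[ b ] (+ fibSum b - (+ n - + f (3 ℕ.+ b)))
      ≡⟨ cong (λ t → sgn b * χ[ b ] t) (regroup (+ fibSum b) (+ f b) (+ f (1 ℕ.+ b)) (+ n)) ⟩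
        sgn b * χ[ b ] (+ fibSum (2 ℕ.+ b) - + n)
      ∎
      where
      regroup : ∀ d a c x → d - (x - ((c + a) + c)) ≡ (d + c) + (c + a) - x
      regroup = solve-∀

  χ[]-shift : ∀ b n → n < f (1 ℕ.+ b) →
    χ[ 4 ℕ.+ b ] (+ n + + f (1 ℕ.+ b) + + f (3 ℕ.+ b)) ≡ χ[ b ] (+ n)
  χ[]-shift b n n<c = begin
      χ[ 4 ℕ.+ b ] N
    ≡⟨ χ[]-suc (3 ℕ.+ b) N ⟩
      χ[ 3 ℕ.+ b ] N - χ[ 3 ℕ.+ b ] (N - + f (4 ℕ.+ b))
    ≡⟨ cong₂ _-_ top bottom ⟩
      (χ[ b ] (m + c) - (χ[ b ] (m + c) - χ[ b ] m - χ[ b ] (m - a))) - χ[ b ] (m - a)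
    ≡⟨ telescope (χ[ b ] (m + c)) (χ[ b ] m) (χ[ b ] (m - a)) ⟩
      χ[ b ] m
    ∎
    where
    open ≡-Reasoning
    m = + n
    a = + f b
    c = + f (1 ℕ.+ b)
    N = m + c + + f (3 ℕ.+ b)

    telescope : ∀ x y z → (x - (x - y - z)) - z ≡ y
    telescope = solve-∀

    m-a<c : m - a ℤ.< c
    m-a<c = ℤP.≤-<-trans (ℤP.i-j≤i m a) (+<+ n<c)

    N-big : fibSum (1 ℕ.+ b) < n ℕ.+ f (1 ℕ.+ b) ℕ.+ f (3 ℕ.+ b)
    N-big = ℕP.<-≤-trans (fibSum<f[2+k] (1 ℕ.+ b)) (ℕP.m≤n+m (f (3 ℕ.+ b)) (n ℕ.+ f (1 ℕ.+ b)))

    m+2c-big : fibSum b < n ℕ.+ f (1 ℕ.+ b) ℕ.+ f (1 ℕ.+ b)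
    m+2c-big = ℕP.<-≤-trans (fibSum<f[2+k] b)
      (ℕP.+-mono-≤ (ℕP.m≤n+m (f (1 ℕ.+ b)) n) (f-≤-suc b))

    high : χ[ 2 ℕ.+ b ] N ≡ χ[ b ] (m + c)
    high = begin
        χ[ 2 ℕ.+ b ] N
      ≡⟨ χ[]-suc (1 ℕ.+ b) N ⟩
        χ[ 1 ℕ.+ b ] N - χ[ 1 ℕ.+ b ] (N - (c + a))
      ≡⟨ cong₂ _-_ (χ[]-vanishes-above (1 ℕ.+ b) (+<+ N-big)) (cong χ[ 1 ℕ.+ b ] (drop-F2 m a c)) ⟩
        0ℤ - χ[ 1 ℕ.+ b ] (m + c + c)
      ≡⟨ cong (_-_ 0ℤ) (χ[]-suc b (m + c + c)) ⟩
        0ℤ - (χ[ b ] (m + c + c) - χ[ b ] (m + c + c - c))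
      ≡⟨ cong₂ (λ u v → 0ℤ - (u - χ[ b ] v)) (χ[]-vanishes-above b (+<+ m+2c-big)) (drop-c (m + c) c) ⟩
        0ℤ - (0ℤ - χ[ b ] (m + c))
      ≡⟨ double-negation (χ[ b ] (m + c)) ⟩
        χ[ b ] (m + c)
      ∎
      where
      double-negation : ∀ x → 0ℤ - (0ℤ - x) ≡ x
      double-negation = solve-∀
      drop-F2 : ∀ x y z → x + z + ((z + y) + z) - (z + y) ≡ x + z + z
      drop-F2 = solve-∀
      drop-c : ∀ x y → x + y - y ≡ x
      drop-c = solve-∀

    middle : χ[ 2 ℕ.+ b ] (m + c) ≡ χ[ b ] (m + c) - χ[ b ] m - χ[ b ] (m - a)
    middle = begin
        χ[ 2 ℕ.+ b ] (m + c)
      ≡⟨ χ[]-suc (1 ℕ.+ b) (m + c) ⟩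
        χ[ 1 ℕ.+ b ] (m + c) - χ[ 1 ℕ.+ b ] (m + c - (c + a))
      ≡⟨ cong₂ _-_ (χ[]-suc b (m + c)) (cong χ[ 1 ℕ.+ b ] (drop-c m a c)) ⟩
        (χ[ b ] (m + c) - χ[ b ] (m + c - c)) - χ[ 1 ℕ.+ b ] (m - a)
      ≡⟨ cong₂ (λ u v → (χ[ b ] (m + c) - χ[ b ] u) - v) (cancel m c) (χ[]-stable (ℕP.n≤1+n b) m-a<c) ⟩
        χ[ b ] (m + c) - χ[ b ] m - χ[ b ] (m - a)
      ∎
      where
      drop-c : ∀ x y z → x + z - (z + y) ≡ x - y
      drop-c = solve-∀
      cancel : ∀ x y → x + y - y ≡ x
      cancel = solve-∀

    top : χ[ 3 ℕ.+ b ] N ≡ χ[ b ] (m + c) - (χ[ b ] (m + c) - χ[ b ] m - χ[ b ] (m - a))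
    top = begin
        χ[ 3 ℕ.+ b ] N
      ≡⟨ χ[]-suc (2 ℕ.+ b) N ⟩
        χ[ 2 ℕ.+ b ] N - χ[ 2 ℕ.+ b ] (N - ((c + a) + c))
      ≡⟨ cong₂ (λ u v → u - χ[ 2 ℕ.+ b ] v) high (drop-F3 m a c) ⟩
        χ[ b ] (m + c) - χ[ 2 ℕ.+ b ] (m + c)
      ≡⟨ cong (_-_ (χ[ b ] (m + c))) middle ⟩
        χ[ b ] (m + c) - (χ[ b ] (m + c) - χ[ b ] m - χ[ b ] (m - a))
      ∎
      where
      drop-F3 : ∀ x y z → x + z + ((z + y) + z) - ((z + y) + z) ≡ x + z
      drop-F3 = solve-∀

    bottom : χ[ 3 ℕ.+ b ] (N - + f (4 ℕ.+ b)) ≡ χ[ b ] (m - a)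
    bottom = trans (cong χ[ 3 ℕ.+ b ] (drop-F4 m a c)) (χ[]-stable (ℕP.m≤n+m b 3) m-a<c)
      where
      drop-F4 : ∀ x y z → x + z + ((z + y) + z) - (((z + y) + z) + (z + y)) ≡ x - y
      drop-F4 = solve-∀

  <f[1+r]⇒≤fibSum : ∀ r {n} → n < f (suc r) → n ≤ fibSum r
  <f[1+r]⇒≤fibSum r {n} n<f = ℕP.+-cancelʳ-≤ 2 n (fibSum r) (begin
      n ℕ.+ 2
    ≡⟨ ℕP.+-suc n 1 ⟩
      suc n ℕ.+ 1
    ≤⟨ ℕP.+-mono-≤ n<f (f-pos r) ⟩
      f (suc r) ℕ.+ f r
    ≡⟨ fibSum-+2 r ⟨
      fibSum r ℕ.+ 2
    ∎)
    where open ℕP.≤-Reasoning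

  f≤1+n⇒fibSum∸n<f : ∀ r {n} → f r ≤ suc n → fibSum r ℕ.∸ n < f (suc r)
  f≤1+n⇒fibSum∸n<f r {n} fr≤1+n = ℕP.m<n+o⇒m∸n<o (fibSum r) n ⦃ ℕ.>-nonZero (f-pos (suc r)) ⦄ (ℕ.s≤s⁻¹ (begin
      suc (suc (fibSum r))
    ≡⟨ ℕP.+-comm 2 (fibSum r) ⟩
      fibSum r ℕ.+ 2
    ≡⟨ fibSum-+2 r ⟩
      f (suc r) ℕ.+ f r
    ≤⟨ ℕP.+-monoʳ-≤ (f (suc r)) fr≤1+n ⟩
      f (suc r) ℕ.+ suc n
    ≡⟨ ℕP.+-comm (f (suc r)) (suc n) ⟩
      suc n ℕ.+ f (suc r)
    ∎))
    where open ℕP.≤-Reasoning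

  χ-reflect : ∀ r n → f r ≤ suc n → n < f (suc r) → χ n ≡ sgn r * χ (fibSum r ℕ.∸ n)
  χ-reflect r n fr≤1+n n<f = begin
      χ n
    ≡⟨ χ-truncate r n<f ⟩
      χ[ r ] (+ n)
    ≡⟨ χ[]-reflect′ r (+ n) ⟩
      sgn r * χ[ r ] (+ fibSum r - + n)
    ≡⟨ cong (λ t → sgn r * χ[ r ] t) (trans (ℤP.m-n≡m⊖n (fibSum r) n) (ℤP.⊖-≥ (<f[1+r]⇒≤fibSum r n<f))) ⟩
      sgn r * χ[ r ] (+ (fibSum r ℕ.∸ n))
    ≡⟨ cong (_*_ (sgn r)) (χ-truncate r (f≤1+n⇒fibSum∸n<f r fr≤1+n)) ⟨
      sgn r * χ (fibSum r ℕ.∸ n)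
    ∎
    where open ≡-Reasoning

  χ-gap : ∀ b n → 2 ℕ.* f (2 ℕ.+ b) ≤ suc n → n < f (1 ℕ.+ b) ℕ.+ f (3 ℕ.+ b) → χ n ≡ 0ℤ
  χ-gap b n 2f≤1+n n<f+f = trans (χ-truncate (3 ℕ.+ b) n<f) (χ[]-gap b n reflectedInRange n<f+f)
    where
    open ℕP.≤-Reasoning
    n<f : n < f (4 ℕ.+ b)
    n<f = ℕP.<-≤-trans n<f+f (begin
        f (1 ℕ.+ b) ℕ.+ f (3 ℕ.+ b)
      ≤⟨ ℕP.+-monoˡ-≤ (f (3 ℕ.+ b)) (f-≤-suc (1 ℕ.+ b)) ⟩
        f (2 ℕ.+ b) ℕ.+ f (3 ℕ.+ b)
      ≡⟨ ℕP.+-comm (f (2 ℕ.+ b)) (f (3 ℕ.+ b)) ⟩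
        f (4 ℕ.+ b)
      ∎)
    reflectedInRange : fibSum (2 ℕ.+ b) < f (1 ℕ.+ b) ℕ.+ n
    reflectedInRange = ℕ.s≤s⁻¹ (begin
        suc (suc (fibSum (2 ℕ.+ b)))
      ≡⟨ ℕP.+-comm 2 (fibSum (2 ℕ.+ b)) ⟩
        fibSum (2 ℕ.+ b) ℕ.+ 2
      ≡⟨ fibSum-+2 (2 ℕ.+ b) ⟩
        f (4 ℕ.+ b)
      ≡⟨ regroup (f (2 ℕ.+ b)) (f (1 ℕ.+ b)) ⟩
        f (1 ℕ.+ b) ℕ.+ 2 ℕ.* f (2 ℕ.+ b)
      ≤⟨ ℕP.+-monoʳ-≤ (f (1 ℕ.+ b)) 2f≤1+n ⟩
        f (1 ℕ.+ b) ℕ.+ suc n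
      ≡⟨ ℕP.+-suc (f (1 ℕ.+ b)) n ⟩
        suc (f (1 ℕ.+ b) ℕ.+ n)
      ∎)
      where
      regroup : ∀ p q → p ℕ.+ q ℕ.+ p ≡ q ℕ.+ 2 ℕ.* p
      regroup = ℕSolver.solve-∀

  χ-shift : ∀ a n → 0 < a → n < f a → χ n ≡ χ (n ℕ.+ f a ℕ.+ f (a ℕ.+ 2))
  χ-shift (suc b) n _ n<f = begin
      χ n
    ≡⟨ χ-truncate b n<f ⟩
      χ[ b ] (+ n)
    ≡⟨ χ[]-shift b n n<f ⟨
      χ[ 4 ℕ.+ b ] (+ (n ℕ.+ f (1 ℕ.+ b) ℕ.+ f (3 ℕ.+ b)))
    ≡⟨ χ-truncate (4 ℕ.+ b) shifted<f ⟨
      χ (n ℕ.+ f (1 ℕ.+ b) ℕ.+ f (3 ℕ.+ b))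
    ≡⟨ cong (λ k → χ (n ℕ.+ f (suc b) ℕ.+ f k)) (ℕP.+-comm 2 (suc b)) ⟩
      χ (n ℕ.+ f (suc b) ℕ.+ f (suc b ℕ.+ 2))
    ∎
    where
    open ≡-Reasoning
    shifted<f : n ℕ.+ f (1 ℕ.+ b) ℕ.+ f (3 ℕ.+ b) < f (5 ℕ.+ b)
    shifted<f = ℕP.+-monoˡ-< (f (3 ℕ.+ b)) (ℕP.<-≤-trans (ℕP.+-monoˡ-< (f (1 ℕ.+ b)) n<f)
      (ℕP.≤-trans (ℕP.+-monoˡ-≤ (f (1 ℕ.+ b)) (f-≤-suc (1 ℕ.+ b))) (f-≤-suc (3 ℕ.+ b))))

open import Data.Nat using (ℕ; suc; _+_; _∸_; _≤_; _<_; z≤n; s≤s)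
import Data.Nat.Properties as ℕP
open import Data.Integer using (+_)
open import Data.Product using (_×_; _,_)
open import Relation.Binary.PropositionalEquality using (_≡_; cong; subst; sym; trans)
open FibonacciProduct

∸1≤⇒≤suc : ∀ {x n} → 0 < x → x ∸ 1 ≤ n → x ≤ suc n
∸1≤⇒≤suc {suc x} _ x≤n = s≤s x≤n

≤∸1⇒< : ∀ {x n} → 0 < x → n ≤ x ∸ 1 → n < x
≤∸1⇒< {suc x} _ n≤x = s≤s n≤x

fibSum≡f[k+2]∸2 : ∀ k → fibSum k ≡ f (k + 2) ∸ 2
fibSum≡f[k+2]∸2 k = trans (sym (ℕP.m+n∸n≡m (fibSum k) 2))
  (trans (cong (_∸ 2) (fibSum-+2 k)) (cong (λ j → f j ∸ 2) (ℕP.+-comm 2 k)))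

lemma5p1 : (n r a : ℕ) → 1 < r →
    ((f r ∸ 1 ≤ n → n ≤ f (r + 1) ∸ 1 →
    χ n ≡ sgn r Data.Integer.* χ (f (r + 2) ∸ 2 ∸ n))
    × (2 Data.Nat.* f r ∸ 1 ≤ n → n ≤ f (r ∸ 1) + f (r + 1) ∸ 1 → χ n ≡ + 0)
    × (n ≤ f r ∸ 1 → r ≤ a → χ n ≡ χ (n + f a + f (a + 2))))
lemma5p1 n r@(suc (suc b)) a (s≤s (s≤s z≤n)) = reflection , vanishing , periodicity
  where
  reflection : f r ∸ 1 ≤ n → n ≤ f (r + 1) ∸ 1 → χ n ≡ sgn r Data.Integer.* χ (f (r + 2) ∸ 2 ∸ n)
  reflection fr∸1≤n n≤f∸1 = subst (λ d → χ n ≡ sgn r Data.Integer.* χ (d ∸ n)) (fibSum≡f[k+2]∸2 r)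
    (χ-reflect r n (∸1≤⇒≤suc (f-pos r) fr∸1≤n)
      (subst (λ k → n < f k) (ℕP.+-comm r 1) (≤∸1⇒< (f-pos (r + 1)) n≤f∸1)))

  vanishing : 2 Data.Nat.* f r ∸ 1 ≤ n → n ≤ f (r ∸ 1) + f (r + 1) ∸ 1 → χ n ≡ + 0
  vanishing 2f∸1≤n n≤f+f∸1 = χ-gap b n
    (∸1≤⇒≤suc (ℕP.<-≤-trans (f-pos r) (ℕP.m≤m+n (f r) (f r + 0))) 2f∸1≤n)
    (subst (λ k → n < f (suc b) + f k) (ℕP.+-comm r 1)
      (≤∸1⇒< (ℕP.<-≤-trans (f-pos (suc b)) (ℕP.m≤m+n (f (suc b)) (f (r + 1)))) n≤f+f∸1))

  periodicity : n ≤ f r ∸ 1 → r ≤ a → χ n ≡ χ (n + f a + f (a + 2))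
  periodicity n≤f∸1 r≤a =
    χ-shift a n (ℕP.<-≤-trans (s≤s z≤n) r≤a) (ℕP.<-≤-trans (≤∸1⇒< (f-pos r) n≤f∸1) (f-mono r≤a))
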